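{- If a nested sequent calculus $\mathsf{NL}$, sound and complete for a logic $\mathsf{L}$, has the nested-sequent uniform interpolation property (NUIP), then $\mathsf{L}$ has the uniform interpolation property (UIP).
   Context: Here $\mathsf{L}\in\{\mathsf{K},\mathsf{D},\mathsf{T}\}$ with corresponding model classes ($\mathsf{L}$-models: finite intransitive trees, irreflexive for $\mathsf{K}$, serial for $\mathsf{D}$, reflexive for $\mathsf{T}$), and $\mathsf{L}$ is sound and complete w.r.t. $\mathsf{L}$-models. Formulas are modal formulas in negation normal form; $\mathit{Var}(X)$ is the set of atomic propositions occurring in $X$. UIP: for every formula $\varphi$ and atom $p$ there are formulas $\forall p\varphi$, $\exists p\varphi$ with $\mathit{Var}(\exists p\varphi),\mathit{Var}(\forall p\varphi)\subseteq\mathit{Var}(\varphi)\setminus\{p\}$, $\vdash_{\mathsf{L}}\varphi\to\exists p\varphi$, $\vdash_{\mathsf{L}}\forall p\varphi\to\varphi$, and for every $\psi$ with $p\notin\mathit{Var}(\psi)$: $\vdash_{\mathsf{L}}\varphi\to\psi$ implies $\vdash_{\mathsf{L}}\exists p\varphi\to\psi$, and $\vdash_{\mathsf{L}}\psi\to\varphi$ implies $\vdash_{\mathsf{L}}\psi\to\forall p\varphi$. Nested sequents $\varphi_1,\dots,\varphi_n,[\Gamma_1],\dots,[\Gamma_m]$ have nodes labelled by finite sequences of naturals (root $1$, box $i$ inside $\sigma$ is $\sigma*i$); $\mathcal{L}(\Gamma)$ is the label set and $\sigma:\varphi\in\Gamma$ means $\varphi$ occurs at node $\sigma$. A multiworld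 interpretation of $\Gamma$ into $\mathcal{M}=(W,R,V)$ is $\mathcal{I}:\mathcal{L}(\Gamma)\to W$ with $\mathcal{I}(\sigma)R\,\mathcal{I}(\sigma*n)$; $\mathcal{M},\mathcal{I}\models\Gamma$ iff $\mathcal{M},\mathcal{I}(\sigma)\models\varphi$ for some $\sigma:\varphi\in\Gamma$. Multiformulas: $\mho::=\sigma:\varphi\mid(\mho\curlywedge\mho)\mid(\mho\curlyvee\mho)$ with $\curlywedge$ multiformula conjunction and $\curlyvee$ multiformula disjunction, interpreted classically with $\mathcal{M},\mathcal{I}\models\sigma:\varphi$ iff $\mathcal{M},\mathcal{I}(\sigma)\models\varphi$. $\mathsf{NL}$ has the NUIP if for each nested sequent $\Gamma$ and atom $p$ there is a multiformula $A_p(\Gamma)$ such that: (i) $\mathit{Var}(A_p(\Gamma))\subseteq\mathit{Var}(\Gamma)\setminus\{p\}$ and $\mathcal{L}(A_p(\Gamma))\subseteq\mathcal{L}(\Gamma)$; (ii) for every multiworld interpretation $\mathcal{I}$ of $\Gamma$ into an $\mathsf{L}$-model $\mathcal{M}$, $\mathcal{M},\mathcal{I}\models A_p(\Gamma)$ implies $\mathcal{M},\mathcal{I}\models\Gamma$; (iii) for every nested sequent $\Sigma$ with $p\notin\mathit{Var}(\Sigma)$ and $\mathcal{L}(\Sigma)=\mathcal{L}(\Gamma)$ and every multiworld interpretation $\mathcal{I}$ of $\Gamma$ into an $\mathsf{L}$-model $\mathcal{M}$, if $\mathcal{M},\mathcal{I}\not\models A_p(\Gamma)$ and $\mathcal{M},\mathcal{I}\not\models\Sigma$,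 then $\mathcal{M}',\mathcal{I}'\not\models\Gamma$ and $\mathcal{M}',\mathcal{I}'\not\models\Sigma$ for some multiworld interpretation $\mathcal{I}'$ of $\Gamma$ into some $\mathsf{L}$-model $\mathcal{M}'$. -}

module Defs where

open import Data.Nat using (ℕ)
open import Data.Bool using (Bool; true)
open import Data.List using (List; []; _∷_; _++_; length; lookup)
open import Data.List.Membership.Propositional using (_∈_)
open import Data.Fin using (Fin; toℕ)
open import Data.Product using (Σ; ∃; ∃-syntax; _×_)
open import Data.Sum using (_⊎_)
open import Data.Unit using (⊤)
open import Data.Empty using (⊥)
open import Relation.Nullary using (¬_)
open import Relation.Binary.PropositionalEquality using (_≡_)

data Logic : Set where
  K D T : Logic

-- Modal formulas in negation normal form (atoms are natural numbers)

data Fm : Set where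
  atom natom : ℕ → Fm
  top bot    : Fm
  _∧'_ _∨'_  : Fm → Fm → Fm
  box dia    : Fm → Fm

neg : Fm → Fm
neg (atom p)  = natom p
neg (natom p) = atom p
neg top       = bot
neg bot       = top
neg (φ ∧' ψ)  = neg φ ∨' neg ψ
neg (φ ∨' ψ)  = neg φ ∧' neg ψ
neg (box φ)   = dia (neg φ)
neg (dia φ)   = box (neg φ)

_⇒_ : Fm → Fm → Fm
φ ⇒ ψ = neg φ ∨' ψ

data OccFm (q : ℕ) : Fm → Set where
  atom  : OccFm q (atom q)
  natom : OccFm q (natom q)
  ∧l : ∀ {φ ψ} → OccFm q φ → OccFm q (φ ∧' ψ)
  ∧r : ∀ {φ ψ} → OccFm q ψ → OccFm q (φ ∧' ψ)
  ∨l : ∀ {φ ψ} → OccFm q φ → OccFm q (φ ∨' ψ)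
  ∨r : ∀ {φ ψ} → OccFm q ψ → OccFm q (φ ∨' ψ)
  box : ∀ {φ} → OccFm q φ → OccFm q (box φ)
  dia : ∀ {φ} → OccFm q φ → OccFm q (dia φ)

-- L-models: finite intransitive trees.  Worlds are the
-- positions in the tree; the basic relation is the child relation.

data Tree : Set where
  node : (ℕ → Bool) → List Tree → Tree

children : Tree → List Tree
children (node _ ts) = ts

data Pos : Tree → Set where
  here  : ∀ {t} → Pos t
  child : ∀ {v ts} (i : Fin (length ts)) → Pos (lookup ts i) → Pos (node v ts)

subtree : ∀ {t} → Pos t → Tree
subtree {t} here = t
subtree (child i w) = subtree w

val : ∀ {t} → Pos t → ℕ → Bool
val w with subtree w
... | node v _ = v

data Succ : ∀ {t} → Pos t → Pos t → Set where
  now  : ∀ {v ts} (i : Fin (length ts)) → Succ {node v ts} here (child i here)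
  deep : ∀ {v ts} (i : Fin (length ts)) {w u : Pos (lookup ts i)} →
         Succ w u → Succ {node v ts} (child i w) (child i u)

Leaf : ∀ {t} → Pos t → Set
Leaf w = children (subtree w) ≡ []

-- accessibility relation of the L-model determined by a tree
--   K : the child relation (irreflexive intransitive tree)
--   D : the child relation plus loops at the leaves (serial)
--   T : the child relation plus all loops (reflexive)
Acc : Logic → (t : Tree) → Pos t → Pos t → Set
Acc K t w u = Succ w u
Acc D t w u = Succ w u ⊎ (w ≡ u × Leaf w)
Acc T t w u = Succ w u ⊎ w ≡ u

Sat : (L : Logic) (t : Tree) → Pos t → Fm → Set
Sat L t w (atom p)  = val w p ≡ true
Sat L t w (natom p) = ¬ (val w p ≡ true)
Sat L t w top       = ⊤
Sat L t w bot       = ⊥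
Sat L t w (φ ∧' ψ)  = Sat L t w φ × Sat L t w ψ
Sat L t w (φ ∨' ψ)  = Sat L t w φ ⊎ Sat L t w ψ
Sat L t w (box φ)   = ∀ u → Acc L t w u → Sat L t u φ
Sat L t w (dia φ)   = ∃[ u ] (Acc L t w u × Sat L t u φ)

-- ⊢_L φ, via soundness and completeness w.r.t. L-models
Valid : Logic → Fm → Set
Valid L φ = ∀ (t : Tree) (w : Pos t) → Sat L t w φ

UIP : Logic → Set
UIP L = ∀ (φ : Fm) (p : ℕ) →
  Σ Fm λ ex → Σ Fm λ all →
    (∀ q → OccFm q ex → OccFm q φ × ¬ (q ≡ p)) ×
    (∀ q → OccFm q all → OccFm q φ × ¬ (q ≡ p)) ×
    Valid L (φ ⇒ ex) ×
    Valid L (all ⇒ φ) ×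
    (∀ ψ → ¬ OccFm p ψ → Valid L (φ ⇒ ψ) → Valid L (ex ⇒ ψ)) ×
    (∀ ψ → ¬ OccFm p ψ → Valid L (ψ ⇒ φ) → Valid L (ψ ⇒ all))

-- Nested sequents  φ₁,…,φₙ,[Γ₁],…,[Γₘ]

data NSeq : Set where
  ns : List Fm → List NSeq → NSeq

-- Labels: the root (written 1 in the paper) is [], and the label of the
-- i-th box inside σ (σ*i) is σ ++ [ i ]  (boxes are numbered from 0).
Label : Set
Label = List ℕ

data InL : NSeq → Label → Set where
  root : ∀ {Γ} → InL Γ []
  sub  : ∀ {fs bs σ} (i : Fin (length bs)) →
         InL (lookup bs i) σ → InL (ns fs bs) (toℕ i ∷ σ)

data At : NSeq → Label → Fm → Set where
  here : ∀ {fs bs φ} → φ ∈ fs → At (ns fs bs) [] φ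
  sub  : ∀ {fs bs σ φ} (i : Fin (length bs)) →
         At (lookup bs i) σ φ → At (ns fs bs) (toℕ i ∷ σ) φ

OccSeq : ℕ → NSeq → Set
OccSeq q Γ = ∃[ σ ] ∃[ φ ] (At Γ σ φ × OccFm q φ)

-- multiworld interpretations of Γ into the L-model given by t
-- (a function on labels; only its values on 𝓛(Γ) matter)
IsMWI : Logic → NSeq → (t : Tree) → (Label → Pos t) → Set
IsMWI L Γ t I = ∀ σ (n : ℕ) → InL Γ (σ ++ n ∷ []) →
                Acc L t (I σ) (I (σ ++ n ∷ []))

SatSeq : (L : Logic) (t : Tree) → (Label → Pos t) → NSeq → Set
SatSeq L t I Γ = ∃[ σ ] ∃[ φ ] (At Γ σ φ × Sat L t (I σ) φ)

data MF : Set where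
  _∶_ : Label → Fm → MF
  _⋏_ _⋎_ : MF → MF → MF

SatMF : (L : Logic) (t : Tree) → (Label → Pos t) → MF → Set
SatMF L t I (σ ∶ φ) = Sat L t (I σ) φ
SatMF L t I (A ⋏ B) = SatMF L t I A × SatMF L t I B
SatMF L t I (A ⋎ B) = SatMF L t I A ⊎ SatMF L t I B

OccMF : ℕ → MF → Set
OccMF q (σ ∶ φ) = OccFm q φ
OccMF q (A ⋏ B) = OccMF q A ⊎ OccMF q B
OccMF q (A ⋎ B) = OccMF q A ⊎ OccMF q B

LabMF : Label → MF → Set
LabMF τ (σ ∶ φ) = τ ≡ σ
LabMF τ (A ⋏ B) = LabMF τ A ⊎ LabMF τ B
LabMF τ (A ⋎ B) = LabMF τ A ⊎ LabMF τ B

NUIP : Logic → Set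
NUIP L = ∀ (Γ : NSeq) (p : ℕ) → Σ MF λ A →
  ((∀ q → OccMF q A → OccSeq q Γ × ¬ (q ≡ p)) ×
   (∀ σ → LabMF σ A → InL Γ σ)) ×
  (∀ (t : Tree) (I : Label → Pos t) → IsMWI L Γ t I →
     SatMF L t I A → SatSeq L t I Γ) ×
  (∀ (Sg : NSeq) → ¬ OccSeq p Sg →
     (∀ σ → (InL Sg σ → InL Γ σ) × (InL Γ σ → InL Sg σ)) →
     ∀ (t : Tree) (I : Label → Pos t) → IsMWI L Γ t I →
     ¬ SatMF L t I A → ¬ SatSeq L t I Sg →
     Σ Tree λ t' → Σ (Label → Pos t') λ I' →
       IsMWI L Γ t' I' × ¬ SatSeq L t' I' Γ × ¬ SatSeq L t' I' Sg)

{-# OPTIONS --safe #-}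
-- A sequent Γ consisting of the single formula χ is interpreted by a single
-- world, and the multiformula A_p(Γ) then collapses to a formula a with the
-- variables of χ minus p.  Clause (ii) gives a ⊨ χ.  If ψ ⊨ χ with p ∉ Var(ψ)
-- but a fails where ψ holds, clause (iii) applied to Σ = ¬ψ yields a world
-- where both χ and ¬ψ fail, i.e. ψ holds and χ fails: so a is ∀p χ.
-- Truth in the finite tree models is decidable, so ∃p φ can then be taken
-- to be ¬ ∀p ¬φ.
module Submission where

open import Defs
open import Data.Nat using (ℕ)
open import Data.Bool using (true; false)
open import Data.List using (List; []; _∷_; _++_; length; map; allFin)
open import Data.List.Membership.Propositional using (_∈_; find)
open import Data.List.Membership.Propositional.Properties
  using (∈-map⁺; ∈-map⁻; ∈-allFin; ∈-++⁻; ∈-++⁺ˡ; ∈-++⁺ʳ)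
open import Data.List.Relation.Unary.All as All using (All; []; _∷_)
open import Data.List.Relation.Unary.Any using (Any; here; there)
open import Data.Product using (Σ; ∃-syntax; _×_; _,_)
open import Data.Sum as Sum using (_⊎_; inj₁; inj₂)
open import Data.Unit using (tt)
open import Data.Empty using (⊥-elim)
open import Function using (_∘_)
open import Relation.Nullary using (¬_)
open import Relation.Binary.PropositionalEquality using (_≡_; refl; cong; cong₂; subst)

all⊎any : ∀ {A : Set} {P Q : A → Set} → (∀ x → P x ⊎ Q x) →
          ∀ xs → All P xs ⊎ Any Q xs
all⊎any P⊎Q [] = inj₁ []
all⊎any P⊎Q (x ∷ xs) with P⊎Q x | all⊎any P⊎Q xs
... | inj₂ qx | _        = inj₂ (here qx)
... | inj₁ px | inj₁ pxs = inj₁ (px ∷ pxs)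
... | inj₁ _  | inj₂ qxs = inj₂ (there qxs)

successors : ∀ {t} → Pos t → List (Pos t)
successors {node v ts} here = map (λ i → child i here) (allFin (length ts))
successors (child i w)      = map (child i) (successors w)

∈-successors⁺ : ∀ {t} {w u : Pos t} → Succ w u → u ∈ successors w
∈-successors⁺ (now i)    = ∈-map⁺ (λ i → child i here) (∈-allFin i)
∈-successors⁺ (deep i s) = ∈-map⁺ (child i) (∈-successors⁺ s)

∈-successors⁻ : ∀ {t} (w : Pos t) {u : Pos t} → u ∈ successors w → Succ w u
∈-successors⁻ {node v ts} here m with ∈-map⁻ (λ i → child i here) m
... | i , _ , refl = now i
∈-successors⁻ (child i w) m with ∈-map⁻ (child i) m
... | u , m′ , refl = deep i (∈-successors⁻ w m′)

whenEmpty : ∀ {A B : Set} → List B → A → List A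
whenEmpty []      a = a ∷ []
whenEmpty (_ ∷ _) a = []

∈-whenEmpty⁺ : ∀ {A B : Set} {xs : List B} (a : A) → xs ≡ [] → a ∈ whenEmpty xs a
∈-whenEmpty⁺ a refl = here refl

∈-whenEmpty⁻ : ∀ {A B : Set} (xs : List B) {a b : A} →
               b ∈ whenEmpty xs a → b ≡ a × xs ≡ []
∈-whenEmpty⁻ [] (here refl) = refl , refl

accessible : Logic → ∀ {t} → Pos t → List (Pos t)
accessible K w = successors w
accessible D w = successors w ++ whenEmpty (children (subtree w)) w
accessible T w = w ∷ successors w

∈-accessible⁺ : ∀ L {t} {w u : Pos t} → Acc L t w u → u ∈ accessible L w
∈-accessible⁺ K s           = ∈-successors⁺ s
∈-accessible⁺ D (inj₁ s)    = ∈-++⁺ˡ (∈-successors⁺ s)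
∈-accessible⁺ D {w = w} (inj₂ (refl , leaf)) =
  ∈-++⁺ʳ (successors w) (∈-whenEmpty⁺ w leaf)
∈-accessible⁺ T (inj₁ s)    = there (∈-successors⁺ s)
∈-accessible⁺ T (inj₂ refl) = here refl

∈-accessible⁻ : ∀ L {t} (w : Pos t) {u : Pos t} → u ∈ accessible L w → Acc L t w u
∈-accessible⁻ K w m = ∈-successors⁻ w m
∈-accessible⁻ D w m with ∈-++⁻ (successors w) m
... | inj₁ m′ = inj₁ (∈-successors⁻ w m′)
... | inj₂ m′ with ∈-whenEmpty⁻ (children (subtree w)) m′
...   | refl , leaf = inj₂ (refl , leaf)
∈-accessible⁻ T w (here refl) = inj₂ refl
∈-accessible⁻ T w (there m)   = inj₁ (∈-successors⁻ w m)

all-accessible : ∀ L {t} {w : Pos t} {P : Pos t → Set} →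
                 All P (accessible L w) → ∀ u → Acc L t w u → P u
all-accessible L ps u a = All.lookup ps (∈-accessible⁺ L a)

any-accessible : ∀ L {t} {w : Pos t} {P : Pos t → Set} →
                 Any P (accessible L w) → ∃[ u ] (Acc L t w u × P u)
any-accessible L {w = w} ps with find ps
... | u , m , pu = u , ∈-accessible⁻ L w m , pu

module _ (L : Logic) {t : Tree} where

  sat⊎sat-neg : ∀ φ (w : Pos t) → Sat L t w φ ⊎ Sat L t w (neg φ)
  sat⊎sat-neg (atom p) w with val w p
  ... | true  = inj₁ refl
  ... | false = inj₂ (λ ())
  sat⊎sat-neg (natom p) w with val w p
  ... | true  = inj₂ refl
  ... | false = inj₁ (λ ())
  sat⊎sat-neg top w = inj₁ tt
  sat⊎sat-neg bot w = inj₂ tt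
  sat⊎sat-neg (φ ∧' ψ) w with sat⊎sat-neg φ w | sat⊎sat-neg ψ w
  ... | inj₁ sφ | inj₁ sψ = inj₁ (sφ , sψ)
  ... | inj₂ nφ | _       = inj₂ (inj₁ nφ)
  ... | inj₁ _  | inj₂ nψ = inj₂ (inj₂ nψ)
  sat⊎sat-neg (φ ∨' ψ) w with sat⊎sat-neg φ w | sat⊎sat-neg ψ w
  ... | inj₁ sφ | _       = inj₁ (inj₁ sφ)
  ... | inj₂ _  | inj₁ sψ = inj₁ (inj₂ sψ)
  ... | inj₂ nφ | inj₂ nψ = inj₂ (nφ , nψ)
  sat⊎sat-neg (box φ) w with all⊎any (sat⊎sat-neg φ) (accessible L w)
  ... | inj₁ all = inj₁ (all-accessible L all)
  ... | inj₂ any = inj₂ (any-accessible L any)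
  sat⊎sat-neg (dia φ) w with all⊎any (Sum.swap ∘ sat⊎sat-neg φ) (accessible L w)
  ... | inj₁ all = inj₂ (all-accessible L all)
  ... | inj₂ any = inj₁ (any-accessible L any)

  sat-neg⇒¬sat : ∀ φ {w : Pos t} → Sat L t w (neg φ) → ¬ Sat L t w φ
  sat-neg⇒¬sat (atom p)  n s = n s
  sat-neg⇒¬sat (natom p) s n = n s
  sat-neg⇒¬sat (φ ∧' ψ) (inj₁ nφ) (sφ , _) = sat-neg⇒¬sat φ nφ sφ
  sat-neg⇒¬sat (φ ∧' ψ) (inj₂ nψ) (_ , sψ) = sat-neg⇒¬sat ψ nψ sψ
  sat-neg⇒¬sat (φ ∨' ψ) (nφ , _) (inj₁ sφ) = sat-neg⇒¬sat φ nφ sφ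
  sat-neg⇒¬sat (φ ∨' ψ) (_ , nψ) (inj₂ sψ) = sat-neg⇒¬sat ψ nψ sψ
  sat-neg⇒¬sat (box φ) (u , a , nφ) all = sat-neg⇒¬sat φ nφ (all u a)
  sat-neg⇒¬sat (dia φ) all (u , a , sφ) = sat-neg⇒¬sat φ (all u a) sφ

  ¬sat⇒sat-neg : ∀ φ {w : Pos t} → ¬ Sat L t w φ → Sat L t w (neg φ)
  ¬sat⇒sat-neg φ {w} ¬s with sat⊎sat-neg φ w
  ... | inj₁ s = ⊥-elim (¬s s)
  ... | inj₂ n = n

  sat-stable : ∀ φ {w : Pos t} → ¬ ¬ Sat L t w φ → Sat L t w φ
  sat-stable φ {w} ¬¬s with sat⊎sat-neg φ w
  ... | inj₁ s = s
  ... | inj₂ n = ⊥-elim (¬¬s (sat-neg⇒¬sat φ n))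

neg-involutive : ∀ φ → neg (neg φ) ≡ φ
neg-involutive (atom p)  = refl
neg-involutive (natom p) = refl
neg-involutive top       = refl
neg-involutive bot       = refl
neg-involutive (φ ∧' ψ)  = cong₂ _∧'_ (neg-involutive φ) (neg-involutive ψ)
neg-involutive (φ ∨' ψ)  = cong₂ _∨'_ (neg-involutive φ) (neg-involutive ψ)
neg-involutive (box φ)   = cong box (neg-involutive φ)
neg-involutive (dia φ)   = cong dia (neg-involutive φ)

occ-neg : ∀ {q} φ → OccFm q (neg φ) → OccFm q φ
occ-neg (atom p)  natom  = atom
occ-neg (natom p) atom   = natom
occ-neg (φ ∧' ψ)  (∨l o) = ∧l (occ-neg φ o)
occ-neg (φ ∧' ψ)  (∨r o) = ∧r (occ-neg ψ o)
occ-neg (φ ∨' ψ)  (∧l o) = ∨l (occ-neg φ o)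
occ-neg (φ ∨' ψ)  (∧r o) = ∨r (occ-neg ψ o)
occ-neg (box φ)   (dia o) = box (occ-neg φ o)
occ-neg (dia φ)   (box o) = dia (occ-neg φ o)

Entails : Logic → Fm → Fm → Set
Entails L φ ψ = ∀ t (w : Pos t) → Sat L t w φ → Sat L t w ψ

valid⇒entails : ∀ L {φ ψ} → Valid L (φ ⇒ ψ) → Entails L φ ψ
valid⇒entails L {φ} v t w sφ with v t w
... | inj₁ nφ = ⊥-elim (sat-neg⇒¬sat L φ nφ sφ)
... | inj₂ sψ = sψ

entails⇒valid : ∀ L {φ ψ} → Entails L φ ψ → Valid L (φ ⇒ ψ)
entails⇒valid L {φ} e t w with sat⊎sat-neg L φ w
... | inj₁ sφ = inj₂ (e t w sφ)
... | inj₂ nφ = inj₁ nφ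

entails-contrapose : ∀ L {φ ψ} → Entails L φ ψ → Entails L (neg ψ) (neg φ)
entails-contrapose L {φ} {ψ} e t w nψ =
  ¬sat⇒sat-neg L φ (sat-neg⇒¬sat L ψ nψ ∘ e t w)

VarsWithout : ℕ → Fm → Fm → Set
VarsWithout p a φ = ∀ q → OccFm q a → OccFm q φ × ¬ q ≡ p

UniformForall : Logic → ℕ → Fm → Fm → Set
UniformForall L p φ a =
  VarsWithout p a φ × Entails L a φ ×
  (∀ ψ → ¬ OccFm p ψ → Entails L ψ φ → Entails L ψ a)

UniformExists : Logic → ℕ → Fm → Fm → Set
UniformExists L p φ e =
  VarsWithout p e φ × Entails L φ e ×
  (∀ ψ → ¬ OccFm p ψ → Entails L φ ψ → Entails L e ψ)

uniformExists-neg : ∀ L {p φ a} → UniformForall L p (neg φ) a →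
                    UniformExists L p φ (neg a)
uniformExists-neg L {p} {φ} {a} (vars , a⊨¬φ , greatest) =
  vars′ , φ⊨¬a , least
  where
  vars′ : VarsWithout p (neg a) φ
  vars′ q o with vars q (occ-neg a o)
  ... | oφ , q≢p = occ-neg φ oφ , q≢p

  φ⊨¬a : Entails L φ (neg a)
  φ⊨¬a = subst (λ χ → Entails L χ (neg a)) (neg-involutive φ)
               (entails-contrapose L a⊨¬φ)

  least : ∀ ψ → ¬ OccFm p ψ → Entails L φ ψ → Entails L (neg a) ψ
  least ψ p∉ψ φ⊨ψ =
    subst (Entails L (neg a)) (neg-involutive ψ)
          (entails-contrapose L (greatest (neg ψ) (p∉ψ ∘ occ-neg ψ)
                                          (entails-contrapose L φ⊨ψ)))

flatten : MF → Fm
flatten (σ ∶ φ) = φ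
flatten (A ⋏ B) = flatten A ∧' flatten B
flatten (A ⋎ B) = flatten A ∨' flatten B

module _ (L : Logic) {t : Tree} (w : Pos t) where

  satMF-const⇒sat-flatten : ∀ A → SatMF L t (λ _ → w) A → Sat L t w (flatten A)
  satMF-const⇒sat-flatten (σ ∶ φ) s       = s
  satMF-const⇒sat-flatten (A ⋏ B) (a , b) =
    satMF-const⇒sat-flatten A a , satMF-const⇒sat-flatten B b
  satMF-const⇒sat-flatten (A ⋎ B) (inj₁ a) = inj₁ (satMF-const⇒sat-flatten A a)
  satMF-const⇒sat-flatten (A ⋎ B) (inj₂ b) = inj₂ (satMF-const⇒sat-flatten B b)

  sat-flatten⇒satMF-const : ∀ A → Sat L t w (flatten A) → SatMF L t (λ _ → w) A
  sat-flatten⇒satMF-const (σ ∶ φ) s       = s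
  sat-flatten⇒satMF-const (A ⋏ B) (a , b) =
    sat-flatten⇒satMF-const A a , sat-flatten⇒satMF-const B b
  sat-flatten⇒satMF-const (A ⋎ B) (inj₁ a) = inj₁ (sat-flatten⇒satMF-const A a)
  sat-flatten⇒satMF-const (A ⋎ B) (inj₂ b) = inj₂ (sat-flatten⇒satMF-const B b)

occ-flatten : ∀ {q} A → OccFm q (flatten A) → OccMF q A
occ-flatten (σ ∶ φ) o      = o
occ-flatten (A ⋏ B) (∧l o) = inj₁ (occ-flatten A o)
occ-flatten (A ⋏ B) (∧r o) = inj₂ (occ-flatten B o)
occ-flatten (A ⋎ B) (∨l o) = inj₁ (occ-flatten A o)
occ-flatten (A ⋎ B) (∨r o) = inj₂ (occ-flatten B o)

singleton : Fm → NSeq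
singleton χ = ns (χ ∷ []) []

at-singleton : ∀ {χ σ φ} → At (singleton χ) σ φ → σ ≡ [] × φ ≡ χ
at-singleton (here (here refl)) = refl , refl

inL-singleton-swap : ∀ {χ χ′ σ} → InL (singleton χ) σ → InL (singleton χ′) σ
inL-singleton-swap root = root

isMWI-singleton : ∀ L χ t (I : Label → Pos t) → IsMWI L (singleton χ) t I
isMWI-singleton L χ t I []      n (sub () _)
isMWI-singleton L χ t I (_ ∷ _) n (sub () _)

satSeq-singleton⁺ : ∀ L {χ t} {I : Label → Pos t} →
                    Sat L t (I []) χ → SatSeq L t I (singleton χ)
satSeq-singleton⁺ L {χ} s = [] , χ , here (here refl) , s

satSeq-singleton⁻ : ∀ L {χ t} {I : Label → Pos t} →
                    SatSeq L t I (singleton χ) → Sat L t (I []) χ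
satSeq-singleton⁻ L (σ , φ , at , s) with at-singleton at
... | refl , refl = s

uniformForall-from-NUIP : ∀ L → NUIP L → ∀ χ p → Σ Fm (UniformForall L p χ)
uniformForall-from-NUIP L nuip χ p with nuip (singleton χ) p
... | A , (vars , _) , A⇒Γ , counter-model = flatten A , vars′ , a⊨χ , greatest
  where
  vars′ : VarsWithout p (flatten A) χ
  vars′ q o with vars q (occ-flatten A o)
  ... | (σ , φ , at , oφ) , q≢p with at-singleton at
  ...   | refl , refl = oφ , q≢p

  a⊨χ : Entails L (flatten A) χ
  a⊨χ t w a = satSeq-singleton⁻ L
    (A⇒Γ t (λ _ → w) (isMWI-singleton L χ t _) (sat-flatten⇒satMF-const L w A a))

  greatest : ∀ ψ → ¬ OccFm p ψ → Entails L ψ χ → Entails L ψ (flatten A)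
  greatest ψ p∉ψ ψ⊨χ t w sψ = sat-stable L (flatten A) refute
    where
    p∉¬ψ : ¬ OccSeq p (singleton (neg ψ))
    p∉¬ψ (σ , φ , at , o) with at-singleton at
    ... | refl , refl = p∉ψ (occ-neg ψ o)

    -- in the model given by clause (iii), ψ holds but χ does not
    refute : ¬ ¬ Sat L t w (flatten A)
    refute ¬a
      with counter-model (singleton (neg ψ)) p∉¬ψ
             (λ σ → inL-singleton-swap , inL-singleton-swap)
             t (λ _ → w) (isMWI-singleton L χ t _)
             (λ A-holds → ¬a (satMF-const⇒sat-flatten L w A A-holds))
             (λ ¬ψ-holds → sat-neg⇒¬sat L ψ (satSeq-singleton⁻ L ¬ψ-holds) sψ)
    ... | t′ , I′ , _ , ¬χ , ¬¬ψ =
      ¬χ (satSeq-singleton⁺ L (ψ⊨χ t′ (I′ []) ψ-holds))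
      where
      ψ-holds : Sat L t′ (I′ []) ψ
      ψ-holds = sat-stable L ψ (¬¬ψ ∘ satSeq-singleton⁺ L ∘ ¬sat⇒sat-neg L ψ)

lemma5 : (L : Logic) → NUIP L → UIP L
lemma5 L nuip φ p with uniformForall-from-NUIP L nuip φ p
                    | uniformForall-from-NUIP L nuip (neg φ) p
... | a , ∀-vars , a⊨φ , ∀-greatest | b , ∀¬-interpolant =
  let ∃-vars , φ⊨∃ , ∃-least = uniformExists-neg L ∀¬-interpolant
  in neg b , a , ∃-vars , ∀-vars ,
     entails⇒valid L φ⊨∃ ,
     entails⇒valid L a⊨φ ,
     (λ ψ p∉ψ ⊢φ⇒ψ → entails⇒valid L (∃-least ψ p∉ψ (valid⇒entails L ⊢φ⇒ψ))) ,
     (λ ψ p∉ψ ⊢ψ⇒φ → entails⇒valid L (∀-greatest ψ p∉ψ (valid⇒entails L ⊢ψ⇒φ)))
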